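{- Let $n$ be an odd positive integer. Then $mon_{n-1}(K_n\Box K_n)=\dfrac{n(n-1)}{2}$.
   Context: $K_n$ is the complete graph on $n$ vertices; $G\Box H$ is the Cartesian product (vertex set $V(G)\times V(H)$, $(u,v)\sim(u',v')$ iff $u=u'$ and $vv'\in E(H)$, or $v=v'$ and $uu'\in E(G)$). For a constant threshold $t$, a $t$-monopoly of a graph is a vertex set $M$ such that every vertex outside $M$ has at least $t$ neighbors in $M$; $mon_t$ is the minimum size of a $t$-monopoly. -}

module Defs where

open import Data.Nat using (ℕ; _*_; _≤_)
open import Data.Bool using (Bool; true; false; _∧_; _∨_; not)
open import Data.Fin using (Fin; remQuot)
open import Data.Fin.Properties using (_≟_)
open import Data.Fin.Subset using (Subset; _∈_; _∉_; _∩_; ∣_∣)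
open import Data.Vec using (tabulate)
open import Data.Product using (_×_; _,_; Σ; ∃)
open import Relation.Nullary.Decidable using (⌊_⌋)
open import Relation.Binary.PropositionalEquality using (_≡_)

Graph : ℕ → Set
Graph N = Fin N → Fin N → Bool

K : (n : ℕ) → Graph n
K n i j = not ⌊ i ≟ j ⌋

-- Cartesian product G □ H; vertex (u , v) ∈ Fin m × Fin n is encoded as
-- the element of Fin (m * n) given by Data.Fin.combine u v (decoded by remQuot).
_□_ : ∀ {m n} → Graph m → Graph n → Graph (m * n)
_□_ {m} {n} G H x y with remQuot {m} n x | remQuot {m} n y
... | u , v | u' , v' = (⌊ u ≟ u' ⌋ ∧ H v v') ∨ (⌊ v ≟ v' ⌋ ∧ G u u')

nbhd : ∀ {N} → Graph N → Fin N → Subset N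
nbhd G x = tabulate (G x)

IsMonopoly : ∀ {N} → ℕ → Graph N → Subset N → Set
IsMonopoly t G M = ∀ x → x ∉ M → t ≤ ∣ M ∩ nbhd G x ∣

MonIs : ∀ {N} → ℕ → Graph N → ℕ → Set
MonIs t G k =
  (Σ _ λ M → IsMonopoly t G M × ∣ M ∣ ≡ k) ×
  (∀ M → IsMonopoly t G M → k ≤ ∣ M ∣)

module Submission where

-- Encode a vertex set M of K_n □ K_n as a Boolean n × n matrix. A cell outside M
-- sees exactly the ones of its row and of its column, so M is a t-monopoly iff
-- every zero cell (u, v) has row u + col v ≥ t ones.
--
-- Lower bound (n = 2m + 1, t = 2m). Double-count the zero cells weighted by the
-- ones of their lines: 2m · #zeros ≤ Σ_lines (#ones · #zeros). A line with x ones
-- and y = 2m + 1 − x zeros has x y ≤ m (m + 1), so 2m · #zeros ≤ 2n m (m + 1),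
-- i.e. #zeros ≤ n (m + 1) and |M| ≥ n² − n (m + 1) = n m.
--
-- Upper bound: the circulant matrix with a one at (u, v) iff (u + v) mod n < m has
-- exactly m ones in every row and column, hence is a monopoly with n m ones.

open import Defs
open import Data.Nat using (ℕ; zero; suc; _+_; _*_; _∸_; _%_; _/_; _≤_; _<ᵇ_; z≤n; s≤s; NonZero)
open import Data.Nat.Properties hiding (_≟_)
open import Data.Nat.DivMod using (m≡m%n+[m/n]*n; m*n/n≡m; [m+n]%n≡m%n; m<n⇒m%n≡m)
open import Data.Nat.Tactic.RingSolver using (solve-∀)
open import Data.Bool using (Bool; true; false; _∧_; _∨_; not)
open import Data.Bool.Properties using (∧-identityʳ; ∧-zeroʳ)
open import Data.Fin using (Fin; zero; suc; toℕ; combine; remQuot; _↑ˡ_; _↑ʳ_)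
open import Data.Fin.Properties using (_≟_; toℕ<n; toℕ-inject₁; toℕ-fromℕ; remQuot-combine; combine-remQuot)
open import Data.Fin.Subset using (Subset; _∉_; _∩_; ∣_∣)
open import Data.Vec using ([]; _∷_; lookup; tabulate)
open import Data.Vec.Properties using (lookup∘tabulate; lookup-zipWith; []=⇒lookup; lookup⇒[]=)
open import Data.Product using (_×_; _,_; uncurry)
open import Function using (_∘_; _⇔_; mk⇔; Equivalence)
open import Relation.Nullary using (yes; no; contradiction)
open import Relation.Nullary.Decidable using (⌊_⌋)
open import Relation.Binary.PropositionalEquality
open import Algebra.Properties.Semiring.Sum +-*-semiring
  using (sum-syntax; sum-cong-≗; sum-replicate-zero; sum-init-last;
         ∑-distrib-+; ∑-comm; *-distribˡ-sum; *-distribʳ-sum)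

ind : Bool → ℕ
ind true = 1
ind false = 0

ind+ind-not : ∀ b → ind b + ind (not b) ≡ 1
ind+ind-not true = refl
ind+ind-not false = refl

∑-const : ∀ n c → ∑[ i < n ] c ≡ n * c
∑-const zero c = refl
∑-const (suc n) c = cong (c +_) (∑-const n c)

∑-mono-≤ : ∀ {n} {g h : Fin n → ℕ} → (∀ i → g i ≤ h i) → ∑[ i < n ] g i ≤ ∑[ i < n ] h i
∑-mono-≤ {zero} _ = z≤n
∑-mono-≤ {suc n} g≤h = +-mono-≤ (g≤h zero) (∑-mono-≤ (g≤h ∘ suc))

∑-↑ : ∀ m n (g : Fin (m + n) → ℕ) →
      ∑[ k < m + n ] g k ≡ ∑[ i < m ] g (i ↑ˡ n) + ∑[ j < n ] g (m ↑ʳ j)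
∑-↑ zero n g = refl
∑-↑ (suc m) n g = trans (cong (g zero +_) (∑-↑ m n (g ∘ suc))) (sym (+-assoc (g zero) _ _))

∑-combine : ∀ m n (g : Fin (m * n) → ℕ) →
            ∑[ k < m * n ] g k ≡ ∑[ i < m ] ∑[ j < n ] g (combine i j)
∑-combine zero n g = refl
∑-combine (suc m) n g =
  trans (∑-↑ n (m * n) g) (cong (∑[ j < n ] g (j ↑ˡ (m * n)) +_) (∑-combine m n (g ∘ (n ↑ʳ_))))

δ : ∀ {n} → Fin n → Fin n → ℕ
δ i j = ind ⌊ i ≟ j ⌋

δ-suc : ∀ {n} (i j : Fin n) → δ (suc i) (suc j) ≡ δ i j
δ-suc i j with i ≟ j
... | yes _ = refl
... | no _ = refl

∑-δ : ∀ {n} (i : Fin n) (g : Fin n → ℕ) → ∑[ j < n ] (δ i j * g j) ≡ g i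
∑-δ {suc n} zero g = trans (cong₂ _+_ (+-identityʳ (g zero)) (sum-replicate-zero n)) (+-identityʳ (g zero))
∑-δ {suc n} (suc i) g = trans (sum-cong-≗ {n} (λ j → cong (_* g (suc j)) (δ-suc i j))) (∑-δ i (g ∘ suc))

∑∑-rows+cols : ∀ {n} (x : Fin n → Fin n → ℕ) (r c : Fin n → ℕ) →
  ∑[ u < n ] ∑[ v < n ] (x u v * r u + x u v * c v) ≡
  ∑[ u < n ] (∑[ v < n ] x u v * r u) + ∑[ v < n ] (∑[ u < n ] x u v * c v)
∑∑-rows+cols {n} x r c = begin
  ∑[ u < n ] ∑[ v < n ] (x u v * r u + x u v * c v)
    ≡⟨ sum-cong-≗ {n} (λ u → ∑-distrib-+ (λ v → x u v * r u) (λ v → x u v * c v)) ⟩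
  ∑[ u < n ] (∑[ v < n ] (x u v * r u) + ∑[ v < n ] (x u v * c v))
    ≡⟨ ∑-distrib-+ (λ u → ∑[ v < n ] (x u v * r u)) (λ u → ∑[ v < n ] (x u v * c v)) ⟩
  ∑[ u < n ] ∑[ v < n ] (x u v * r u) + ∑[ u < n ] ∑[ v < n ] (x u v * c v)
    ≡⟨ cong₂ _+_ (sum-cong-≗ {n} (λ u → *-distribʳ-sum (r u) (x u))) (∑-comm (λ v u → x u v * c v)) ⟨
  ∑[ u < n ] (∑[ v < n ] x u v * r u) + ∑[ v < n ] ∑[ u < n ] (x u v * c v)
    ≡⟨ cong (∑[ u < n ] (∑[ v < n ] x u v * r u) +_) (sum-cong-≗ {n} (λ v → *-distribʳ-sum (c v) (λ u → x u v))) ⟨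
  ∑[ u < n ] (∑[ v < n ] x u v * r u) + ∑[ v < n ] (∑[ u < n ] x u v * c v) ∎
  where open ≡-Reasoning

∑-toℕ-last : ∀ n (h : ℕ → ℕ) → ∑[ i < suc n ] h (toℕ i) ≡ ∑[ i < n ] h (toℕ i) + h n
∑-toℕ-last n h =
  trans (sum-init-last {n} (h ∘ toℕ))
        (cong₂ _+_ (sum-cong-≗ {n} (cong h ∘ toℕ-inject₁)) (cong h (toℕ-fromℕ n)))

∑-toℕ-rotate : ∀ n (h : ℕ → ℕ) → h n ≡ h 0 →
               ∑[ i < n ] h (suc (toℕ i)) ≡ ∑[ i < n ] h (toℕ i)
∑-toℕ-rotate n h hn≡h0 = +-cancelʳ-≡ (h 0) _ _ (begin
  ∑[ i < n ] h (suc (toℕ i)) + h 0  ≡⟨ +-comm _ (h 0) ⟩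
  ∑[ i < suc n ] h (toℕ i)          ≡⟨ ∑-toℕ-last n h ⟩
  ∑[ i < n ] h (toℕ i) + h n        ≡⟨ cong (∑[ i < n ] h (toℕ i) +_) hn≡h0 ⟩
  ∑[ i < n ] h (toℕ i) + h 0        ∎)
  where open ≡-Reasoning

∑-toℕ-translate : ∀ n (h : ℕ → ℕ) → (∀ x → h (x + n) ≡ h x) →
                  ∀ k → ∑[ i < n ] h (k + toℕ i) ≡ ∑[ i < n ] h (toℕ i)
∑-toℕ-translate n h periodic zero = refl
∑-toℕ-translate n h periodic (suc k) = begin
  ∑[ i < n ] h (suc k + toℕ i)    ≡⟨ sum-cong-≗ {n} (λ i → cong h (sym (+-suc k (toℕ i)))) ⟩
  ∑[ i < n ] h (k + suc (toℕ i))  ≡⟨ ∑-toℕ-rotate n (h ∘ (k +_)) (trans (periodic k) (cong h (sym (+-identityʳ k)))) ⟩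
  ∑[ i < n ] h (k + toℕ i)        ≡⟨ ∑-toℕ-translate n h periodic k ⟩
  ∑[ i < n ] h (toℕ i)            ∎
  where open ≡-Reasoning

∑-toℕ-<ᵇ : ∀ {n k} → k ≤ n → ∑[ i < n ] ind (toℕ i <ᵇ k) ≡ k
∑-toℕ-<ᵇ {n} z≤n = sum-replicate-zero n
∑-toℕ-<ᵇ (s≤s k≤n) = cong suc (∑-toℕ-<ᵇ k≤n)

x≤m⇒x*y≤m*[1+m] : ∀ {m x y} → x ≤ m → x + y ≡ suc (m + m) → x * y ≤ m * suc m
x≤m⇒x*y≤m*[1+m] {x = x} {y} x≤m x+y≡1+2m with m≤n⇒∃[o]m+o≡n x≤m
... | d , refl with +-cancelˡ-≡ x y (suc (d + (x + d)))
                     (trans x+y≡1+2m (trans (cong suc (+-assoc x d (x + d))) (sym (+-suc x _))))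
... | refl = subst (x * y ≤_) (square-split x d) (m≤m+n (x * y) (d * suc d))
  where
  square-split : ∀ x d → x * suc (d + (x + d)) + d * suc d ≡ (x + d) * suc (x + d)
  square-split = solve-∀

x*y≤m*[1+m] : ∀ m x y → x + y ≡ suc (m + m) → x * y ≤ m * suc m
x*y≤m*[1+m] m x y x+y≡1+2m with x ≤? m
... | yes x≤m = x≤m⇒x*y≤m*[1+m] x≤m x+y≡1+2m
... | no x≰m =
  subst (_≤ m * suc m) (*-comm y x) (x≤m⇒x*y≤m*[1+m] y≤m (trans (+-comm y x) x+y≡1+2m))
  where
  y≤m : y ≤ m
  y≤m = +-cancelˡ-≤ (suc m) y m (subst (suc m + y ≤_) x+y≡1+2m (+-monoˡ-≤ y (≰⇒> x≰m)))

n*m≤ones : ∀ m S Z → S + Z ≡ suc (m + m) * suc (m + m) →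
  (m + m) * Z ≤ suc (m + m) * (m * suc m) + suc (m + m) * (m * suc m) →
  suc (m + m) * m ≤ S
n*m≤ones zero S Z _ _ = z≤n
n*m≤ones m@(suc _) S Z S+Z≡n*n 2mZ≤2B = +-cancelʳ-≤ (n * suc m) (n * m) S (begin
  n * m + n * suc m  ≡⟨ split-square m ⟩
  n * n              ≡⟨ S+Z≡n*n ⟨
  S + Z              ≤⟨ +-monoʳ-≤ S Z≤n*[1+m] ⟩
  S + n * suc m      ∎)
  where
  open ≤-Reasoning
  n = suc (m + m)
  split-square : ∀ m → suc (m + m) * m + suc (m + m) * suc m ≡ suc (m + m) * suc (m + m)
  split-square = solve-∀
  factor-doubled : ∀ m → suc (m + m) * (m * suc m) + suc (m + m) * (m * suc m) ≡ (m + m) * (suc (m + m) * suc m)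
  factor-doubled = solve-∀
  Z≤n*[1+m] : Z ≤ n * suc m
  Z≤n*[1+m] = *-cancelˡ-≤ (m + m) (subst ((m + m) * Z ≤_) (factor-doubled m) 2mZ≤2B)

Matrix : ℕ → Set
Matrix n = Fin n → Fin n → Bool

col : ∀ {n} → Matrix n → Fin n → Fin n → Bool
col f v u = f u v

weight : ∀ {n} → (Fin n → Bool) → ℕ
weight {n} b = ∑[ i < n ] ind (b i)

weight-cong : ∀ {n} {b c : Fin n → Bool} → (∀ i → b i ≡ c i) → weight b ≡ weight c
weight-cong {n} b≗c = sum-cong-≗ {n} (cong ind ∘ b≗c)

weight+weight-not : ∀ {n} (b : Fin n → Bool) → weight b + weight (not ∘ b) ≡ n
weight+weight-not {n} b = begin
  weight b + weight (not ∘ b)               ≡⟨ ∑-distrib-+ (ind ∘ b) (ind ∘ not ∘ b) ⟨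
  ∑[ i < n ] (ind (b i) + ind (not (b i)))  ≡⟨ sum-cong-≗ {n} (ind+ind-not ∘ b) ⟩
  ∑[ i < n ] 1                              ≡⟨ ∑-const n 1 ⟩
  n * 1                                     ≡⟨ *-identityʳ n ⟩
  n                                         ∎
  where open ≡-Reasoning

IsMatrixMonopoly : ∀ {n} → ℕ → Matrix n → Set
IsMatrixMonopoly t f = ∀ u v → f u v ≡ false → t ≤ weight (f u) + weight (col f v)

IsMatrixMonopoly-cong : ∀ {n t} {f g : Matrix n} → (∀ u v → f u v ≡ g u v) →
  IsMatrixMonopoly t f → IsMatrixMonopoly t g
IsMatrixMonopoly-cong {t = t} f≗g mono u v guv≡false =
  subst (t ≤_) (cong₂ _+_ (weight-cong (f≗g u)) (weight-cong (λ u' → f≗g u' v)))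
        (mono u v (trans (f≗g u v) guv≡false))

zeros-double-count : ∀ {n} t (f : Matrix n) → IsMatrixMonopoly t f →
  t * ∑[ u < n ] weight (not ∘ f u) ≤
    ∑[ u < n ] (weight (not ∘ f u) * weight (f u)) +
    ∑[ v < n ] (weight (not ∘ col f v) * weight (col f v))
zeros-double-count {n} t f mono = begin
  t * ∑[ u < n ] weight (not ∘ f u)                  ≡⟨ *-distribˡ-sum t (λ u → weight (not ∘ f u)) ⟩
  ∑[ u < n ] (t * weight (not ∘ f u))                ≡⟨ sum-cong-≗ {n} (λ u → *-distribˡ-sum t (z u)) ⟩
  ∑[ u < n ] ∑[ v < n ] (t * z u v)                  ≤⟨ ∑-mono-≤ (λ u → ∑-mono-≤ (weigh u)) ⟩
  ∑[ u < n ] ∑[ v < n ] (z u v * r u + z u v * c v)  ≡⟨ ∑∑-rows+cols z r c ⟩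
  ∑[ u < n ] (weight (not ∘ f u) * r u) + ∑[ v < n ] (weight (not ∘ col f v) * c v) ∎
  where
  open ≤-Reasoning
  z : Fin n → Fin n → ℕ
  z u v = ind (not (f u v))
  r c : Fin n → ℕ
  r u = weight (f u)
  c v = weight (col f v)
  weigh : ∀ u v → t * z u v ≤ z u v * r u + z u v * c v
  weigh u v with f u v in fuv
  ... | true = subst (_≤ 0) (sym (*-zeroʳ t)) z≤n
  ... | false = subst₂ _≤_ (sym (*-identityʳ t)) (sym (cong₂ _+_ (+-identityʳ (r u)) (+-identityʳ (c v))))
                       (mono u v fuv)

matrixMonopoly-lower-bound : ∀ m (f : Matrix (suc (m + m))) → IsMatrixMonopoly (m + m) f →
  suc (m + m) * m ≤ ∑[ u < suc (m + m) ] weight (f u)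
matrixMonopoly-lower-bound m f mono = n*m≤ones m _ _ ones+zeros≡n*n
  (≤-trans (zeros-double-count (m + m) f mono)
           (+-mono-≤ (∑-line-products≤ f) (∑-line-products≤ (col f))))
  where
  n = suc (m + m)
  ∑-line-products≤ : (g : Matrix n) → ∑[ u < n ] (weight (not ∘ g u) * weight (g u)) ≤ n * (m * suc m)
  ∑-line-products≤ g = subst (∑[ u < n ] (weight (not ∘ g u) * weight (g u)) ≤_) (∑-const n (m * suc m))
    (∑-mono-≤ (λ u → x*y≤m*[1+m] m (weight (not ∘ g u)) (weight (g u))
                       (trans (+-comm (weight (not ∘ g u)) (weight (g u))) (weight+weight-not (g u)))))
  ones+zeros≡n*n : ∑[ u < n ] weight (f u) + ∑[ u < n ] weight (not ∘ f u) ≡ n * n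
  ones+zeros≡n*n = trans (sym (∑-distrib-+ (weight ∘ f) (λ u → weight (not ∘ f u))))
                         (trans (sum-cong-≗ {n} (weight+weight-not ∘ f)) (∑-const n n))

-- Each line meets every residue class mod N exactly once.
circulant : ∀ N .{{_ : NonZero N}} → ℕ → Matrix N
circulant N k u v = (toℕ u + toℕ v) % N <ᵇ k

module _ (N : ℕ) .{{_ : NonZero N}} {k : ℕ} (k≤N : k ≤ N) where

  weight-circulant-row : ∀ u → weight (circulant N k u) ≡ k
  weight-circulant-row u = begin
    ∑[ v < N ] h (toℕ u + toℕ v)  ≡⟨ ∑-toℕ-translate N h (λ x → cong (ind ∘ (_<ᵇ k)) ([m+n]%n≡m%n x N)) (toℕ u) ⟩
    ∑[ v < N ] h (toℕ v)          ≡⟨ sum-cong-≗ {N} (λ v → cong (ind ∘ (_<ᵇ k)) (m<n⇒m%n≡m (toℕ<n v))) ⟩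
    ∑[ v < N ] ind (toℕ v <ᵇ k)   ≡⟨ ∑-toℕ-<ᵇ k≤N ⟩
    k                             ∎
    where
    open ≡-Reasoning
    h : ℕ → ℕ
    h x = ind (x % N <ᵇ k)

  weight-circulant-col : ∀ v → weight (col (circulant N k) v) ≡ k
  weight-circulant-col v =
    trans (weight-cong {N} (λ u → cong (λ s → s % N <ᵇ k) (+-comm (toℕ u) (toℕ v)))) (weight-circulant-row v)

  circulant-isMatrixMonopoly : IsMatrixMonopoly (k + k) (circulant N k)
  circulant-isMatrixMonopoly u v _ =
    ≤-reflexive (sym (cong₂ _+_ (weight-circulant-row u) (weight-circulant-col v)))

rook-adjacent : ∀ {n} → Fin n × Fin n → Fin n × Fin n → Bool
rook-adjacent (u , v) (u' , v') = (⌊ u ≟ u' ⌋ ∧ not ⌊ v ≟ v' ⌋) ∨ (⌊ v ≟ v' ⌋ ∧ not ⌊ u ≟ u' ⌋)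

∑-rook-neighbours : ∀ {n} (f : Matrix n) u v → f u v ≡ false →
  ∑[ u' < n ] ∑[ v' < n ] ind (f u' v' ∧ rook-adjacent (u , v) (u' , v')) ≡ weight (f u) + weight (col f v)
∑-rook-neighbours {n} f u v fuv≡false = begin
  ∑[ u' < n ] ∑[ v' < n ] ind (f u' v' ∧ rook-adjacent (u , v) (u' , v'))
    ≡⟨ sum-cong-≗ {n} (λ u' → sum-cong-≗ {n} (split u')) ⟩
  ∑[ u' < n ] ∑[ v' < n ] (δ u u' * ind (f u v') + δ v v' * ind (f u' v))
    ≡⟨ sum-cong-≗ {n} (λ u' → ∑-distrib-+ (λ v' → δ u u' * ind (f u v')) (λ v' → δ v v' * ind (f u' v))) ⟩
  ∑[ u' < n ] (∑[ v' < n ] (δ u u' * ind (f u v')) + ∑[ v' < n ] (δ v v' * ind (f u' v)))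
    ≡⟨ sum-cong-≗ {n} (λ u' → cong₂ _+_ (sym (*-distribˡ-sum (δ u u') (ind ∘ f u))) (∑-δ v (λ _ → ind (f u' v)))) ⟩
  ∑[ u' < n ] (δ u u' * weight (f u) + ind (f u' v))
    ≡⟨ ∑-distrib-+ (λ u' → δ u u' * weight (f u)) (λ u' → ind (f u' v)) ⟩
  ∑[ u' < n ] (δ u u' * weight (f u)) + weight (col f v)
    ≡⟨ cong (_+ weight (col f v)) (∑-δ u (λ _ → weight (f u))) ⟩
  weight (f u) + weight (col f v) ∎
  where
  open ≡-Reasoning
  split : ∀ u' v' → ind (f u' v' ∧ rook-adjacent (u , v) (u' , v')) ≡ δ u u' * ind (f u v') + δ v v' * ind (f u' v)
  split u' v' with u ≟ u' | v ≟ v'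
  ... | yes refl | yes refl rewrite fuv≡false = refl
  ... | yes refl | no _ = trans (cong ind (∧-identityʳ (f u v'))) (sym (trans (+-identityʳ _) (+-identityʳ _)))
  ... | no _ | yes refl = trans (cong ind (∧-identityʳ (f u' v))) (sym (+-identityʳ _))
  ... | no _ | no _ = cong ind (∧-zeroʳ (f u' v'))

∣p∣≡∑ : ∀ {N} (p : Subset N) → ∣ p ∣ ≡ ∑[ x < N ] ind (lookup p x)
∣p∣≡∑ [] = refl
∣p∣≡∑ (true ∷ p) = cong suc (∣p∣≡∑ p)
∣p∣≡∑ (false ∷ p) = ∣p∣≡∑ p

∉⇒lookup≡false : ∀ {N} (p : Subset N) x → x ∉ p → lookup p x ≡ false
∉⇒lookup≡false p x x∉p with lookup p x in eq
... | true = contradiction (lookup⇒[]= x p eq) x∉p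
... | false = refl

lookup≡false⇒∉ : ∀ {N} (p : Subset N) x → lookup p x ≡ false → x ∉ p
lookup≡false⇒∉ p x px≡false x∈p with trans (sym ([]=⇒lookup x∈p)) px≡false
... | ()

toMatrix : ∀ {n} → Subset (n * n) → Matrix n
toMatrix M u v = lookup M (combine u v)

fromMatrix : ∀ {n} → Matrix n → Subset (n * n)
fromMatrix {n} f = tabulate (uncurry f ∘ remQuot n)

toMatrix-fromMatrix : ∀ {n} (f : Matrix n) u v → toMatrix (fromMatrix f) u v ≡ f u v
toMatrix-fromMatrix {n} f u v =
  trans (lookup∘tabulate (uncurry f ∘ remQuot n) (combine u v)) (cong (uncurry f) (remQuot-combine u v))

∣M∣≡∑weight : ∀ {n} (M : Subset (n * n)) → ∣ M ∣ ≡ ∑[ u < n ] weight (toMatrix M u)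
∣M∣≡∑weight {n} M = trans (∣p∣≡∑ M) (∑-combine n n (ind ∘ lookup M))

K□K-combine : ∀ {n} (u v u' v' : Fin n) →
  (K n □ K n) (combine u v) (combine u' v') ≡ rook-adjacent (u , v) (u' , v')
K□K-combine u v u' v' = cong₂ rook-adjacent (remQuot-combine u v) (remQuot-combine u' v')

∣M∩nbhd∣ : ∀ {n} (M : Subset (n * n)) u v → toMatrix M u v ≡ false →
  ∣ M ∩ nbhd (K n □ K n) (combine u v) ∣ ≡ weight (toMatrix M u) + weight (col (toMatrix M) v)
∣M∩nbhd∣ {n} M u v uv∉M = begin
  ∣ M ∩ N ∣                                                  ≡⟨ ∣p∣≡∑ (M ∩ N) ⟩
  ∑[ x < n * n ] ind (lookup (M ∩ N) x)                      ≡⟨ sum-cong-≗ {n * n} (cong ind ∘ lookup-∩) ⟩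
  ∑[ x < n * n ] ind (lookup M x ∧ (K n □ K n) (combine u v) x)  ≡⟨ ∑-combine n n _ ⟩
  ∑[ u' < n ] ∑[ v' < n ] ind (toMatrix M u' v' ∧ (K n □ K n) (combine u v) (combine u' v'))
    ≡⟨ sum-cong-≗ {n} (λ u' → sum-cong-≗ {n} (λ v' →
         cong (ind ∘ (toMatrix M u' v' ∧_)) (K□K-combine u v u' v'))) ⟩
  ∑[ u' < n ] ∑[ v' < n ] ind (toMatrix M u' v' ∧ rook-adjacent (u , v) (u' , v'))
    ≡⟨ ∑-rook-neighbours (toMatrix M) u v uv∉M ⟩
  weight (toMatrix M u) + weight (col (toMatrix M) v) ∎
  where
  open ≡-Reasoning
  N = nbhd (K n □ K n) (combine u v)
  lookup-∩ : ∀ x → lookup (M ∩ N) x ≡ lookup M x ∧ (K n □ K n) (combine u v) x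
  lookup-∩ x = trans (lookup-zipWith _∧_ x M N) (cong (lookup M x ∧_) (lookup∘tabulate ((K n □ K n) (combine u v)) x))

IsMonopoly⇔IsMatrixMonopoly : ∀ {n} t (M : Subset (n * n)) →
  IsMonopoly t (K n □ K n) M ⇔ IsMatrixMonopoly t (toMatrix M)
IsMonopoly⇔IsMatrixMonopoly {n} t M = mk⇔ to from
  where
  to : IsMonopoly t (K n □ K n) M → IsMatrixMonopoly t (toMatrix M)
  to mono u v uv∉M = subst (t ≤_) (∣M∩nbhd∣ M u v uv∉M) (mono (combine u v) (lookup≡false⇒∉ M _ uv∉M))
  from : IsMatrixMonopoly t (toMatrix M) → IsMonopoly t (K n □ K n) M
  from mono x = subst (λ y → y ∉ M → t ≤ ∣ M ∩ nbhd (K n □ K n) y ∣) (combine-remQuot {n} n x)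
                      (at (remQuot n x))
    where
    at : ∀ p → uncurry combine p ∉ M → t ≤ ∣ M ∩ nbhd (K n □ K n) (uncurry combine p) ∣
    at (u , v) uv∉M = subst (t ≤_) (sym (∣M∩nbhd∣ M u v uv∉M′)) (mono u v uv∉M′)
      where
      uv∉M′ : toMatrix M u v ≡ false
      uv∉M′ = ∉⇒lookup≡false M (combine u v) uv∉M

mon-K□K-odd : ∀ m → let n = suc (m + m) in MonIs (m + m) (K n □ K n) (n * m)
mon-K□K-odd m = (fromMatrix C , monopoly , size) , minimal
  where
  n = suc (m + m)
  C = circulant n m
  C≗ : ∀ u v → C u v ≡ toMatrix (fromMatrix C) u v
  C≗ u v = sym (toMatrix-fromMatrix C u v)
  m≤n : m ≤ n
  m≤n = ≤-trans (m≤m+n m m) (n≤1+n (m + m))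
  monopoly : IsMonopoly (m + m) (K n □ K n) (fromMatrix C)
  monopoly = Equivalence.from (IsMonopoly⇔IsMatrixMonopoly {n} (m + m) (fromMatrix C))
               (IsMatrixMonopoly-cong C≗ (circulant-isMatrixMonopoly n m≤n))
  size : ∣ fromMatrix C ∣ ≡ n * m
  size = begin
    ∣ fromMatrix C ∣                               ≡⟨ ∣M∣≡∑weight {n} (fromMatrix C) ⟩
    ∑[ u < n ] weight (toMatrix (fromMatrix C) u)  ≡⟨ sum-cong-≗ {n} (λ u → weight-cong (λ v → sym (C≗ u v))) ⟩
    ∑[ u < n ] weight (C u)                        ≡⟨ sum-cong-≗ {n} (weight-circulant-row n m≤n) ⟩
    ∑[ u < n ] m                                   ≡⟨ ∑-const n m ⟩
    n * m                                          ∎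
    where open ≡-Reasoning
  minimal : ∀ M → IsMonopoly (m + m) (K n □ K n) M → n * m ≤ ∣ M ∣
  minimal M mono = subst (n * m ≤_) (sym (∣M∣≡∑weight {n} M))
    (matrixMonopoly-lower-bound m (toMatrix M) (Equivalence.to (IsMonopoly⇔IsMatrixMonopoly {n} (m + m) M) mono))

theorem5 : (n : ℕ) → n % 2 ≡ 1 →
    MonIs (n ∸ 1) (K n □ K n) ((n * (n ∸ 1)) / 2)
theorem5 n n%2≡1 = subst (λ n → MonIs (n ∸ 1) (K n □ K n) ((n * (n ∸ 1)) / 2)) (sym n≡1+2m)
  (subst (MonIs (m + m) (K N □ K N)) (sym N*[m+m]/2≡N*m) (mon-K□K-odd m))
  where
  m = n / 2
  N = suc (m + m)
  n≡1+2m : n ≡ N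
  n≡1+2m = trans (m≡m%n+[m/n]*n n 2) (cong₂ _+_ n%2≡1 (trans (*-comm m 2) (cong (m +_) (+-identityʳ m))))
  N*[m+m]/2≡N*m : (N * (m + m)) / 2 ≡ N * m
  N*[m+m]/2≡N*m = trans (cong (_/ 2) (doubling N m)) (m*n/n≡m (N * m) 2)
    where
    doubling : ∀ a b → a * (b + b) ≡ a * b * 2
    doubling = solve-∀
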